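{- Let $(S_1,\circ)$ and $(S_2,\bullet)$ be partial semigroups. If $(Q,\le,\circ,\bullet)$ is a bi-quantale (respectively a distributive bi-quantale), then so is $(Q^{S_1\times S_2},\le,\circ,\bullet)$. It is unital whenever $Q$ is unital and $S_1$ and $S_2$ are partial monoids. The convolution $\circ$ (respectively $\bullet$) on $Q^{S_1\times S_2}$ is commutative if the operation $\circ$ on $S_1$ and on $Q$ (respectively $\bullet$ on $S_2$ and on $Q$) is commutative.
   Context: A partial semigroup has an associative partial operation (undefined products denoted $\bot$, not an element); a partial monoid additionally has a unit. A bi-quantale $(Q,\le,\circ,\bullet)$ is a complete lattice with two multiplications such that $(Q,\le,\circ)$ and $(Q,\le,\bullet)$ are quantales (associative multiplication distributing over arbitrary suprema on both sides); distributive if binary meets distribute over arbitrary joins and binary joins over arbitrary meets; unital if both multiplications have units $1_\circ$, $1_\bullet$ (possibly different). On $Q^{S_1\times S_2}$ (curried, $F\,x\,y$): order, suprema, infima pointwise; $(F\circ G)\,x\,y=\sum_{x=x_1\circ x_2}F\,x_1\,y\circ G\,x_2\,y$ and $(F\bullet G)\,x\,y=\sum_{y=y_1\bullet y_2}F\,x\,y_1\bullet G\,x\,y_2$ (sums over decompositions with defined products); units $\mathbb{1}_\circ\,x\,y=1_\circ$ if $x=1_\circ$ and $0$ otherwise, $\mathbb{1}_\bullet\,x\,y=1_\bullet$ if $y=1_\bullet$ and $0$ otherwise. -}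

module Defs where

open import Level using (Level; _⊔_; Lift; lift) renaming (suc to lsuc)
open import Data.Bool using (Bool; true; false; if_then_else_)
open import Data.Maybe using (Maybe; just; nothing; _>>=_)
open import Data.Product using (Σ; _×_; _,_)
open import Relation.Binary.PropositionalEquality using (_≡_)
open import Relation.Binary.Structures using (IsPartialOrder)
open import Relation.Binary.Core using (Rel)

-- Partial semigroups / partial monoids.
-- The partial operation returns 'nothing' when the product is undefined (⊥).

record PartialSemigroup (i : Level) : Set (lsuc i) where
  field
    Carrier : Set i
    _·_     : Carrier → Carrier → Maybe Carrier
    -- (x·y)·z is defined iff x·(y·z) is, and then they are equal
    assoc   : ∀ x y z → ((x · y) >>= (λ u → u · z)) ≡ ((y · z) >>= (λ v → x · v))

record IsPartialMonoidUnit {i} (S : PartialSemigroup i)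
                           (e : PartialSemigroup.Carrier S) : Set i where
  open PartialSemigroup S
  field
    identityˡ : ∀ x → (e · x) ≡ just x
    identityʳ : ∀ x → (x · e) ≡ just x

PSCommutative : ∀ {i} → PartialSemigroup i → Set i
PSCommutative S = ∀ x y → (x · y) ≡ (y · x)
  where open PartialSemigroup S

record RawBiQuantale (c ℓ₁ ℓ₂ i : Level) : Set (lsuc (c ⊔ ℓ₁ ⊔ ℓ₂ ⊔ i)) where
  infixl 7 _∘_ _•_
  field
    Carrier : Set c
    _≈_     : Rel Carrier ℓ₁
    _≤_     : Rel Carrier ℓ₂
    ⋁       : {I : Set i} → (I → Carrier) → Carrier
    ⋀       : {I : Set i} → (I → Carrier) → Carrier
    _∘_     : Carrier → Carrier → Carrier
    _•_     : Carrier → Carrier → Carrier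

  _∨_ : Carrier → Carrier → Carrier
  x ∨ y = ⋁ {Lift i Bool} (λ { (lift b) → if b then x else y })

  _∧_ : Carrier → Carrier → Carrier
  x ∧ y = ⋀ {Lift i Bool} (λ { (lift b) → if b then x else y })

record IsBiQuantale {c ℓ₁ ℓ₂ i} (Q : RawBiQuantale c ℓ₁ ℓ₂ i)
                    : Set (c ⊔ ℓ₁ ⊔ ℓ₂ ⊔ lsuc i) where
  open RawBiQuantale Q
  field
    isPartialOrder : IsPartialOrder _≈_ _≤_
    ⋁-upper : ∀ {I : Set i} (f : I → Carrier) j → f j ≤ ⋁ f
    ⋁-least : ∀ {I : Set i} (f : I → Carrier) x → (∀ j → f j ≤ x) → ⋁ f ≤ x
    ⋀-lower : ∀ {I : Set i} (f : I → Carrier) j → ⋀ f ≤ f j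
    ⋀-great : ∀ {I : Set i} (f : I → Carrier) x → (∀ j → x ≤ f j) → x ≤ ⋀ f
    ∘-cong    : ∀ {a a′ b b′} → a ≈ a′ → b ≈ b′ → (a ∘ b) ≈ (a′ ∘ b′)
    ∘-assoc   : ∀ a b c → ((a ∘ b) ∘ c) ≈ (a ∘ (b ∘ c))
    ∘-distribˡ : ∀ a {I : Set i} (f : I → Carrier) → (a ∘ ⋁ f) ≈ ⋁ (λ j → a ∘ f j)
    ∘-distribʳ : ∀ a {I : Set i} (f : I → Carrier) → (⋁ f ∘ a) ≈ ⋁ (λ j → f j ∘ a)
    •-cong    : ∀ {a a′ b b′} → a ≈ a′ → b ≈ b′ → (a • b) ≈ (a′ • b′)
    •-assoc   : ∀ a b c → ((a • b) • c) ≈ (a • (b • c))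
    •-distribˡ : ∀ a {I : Set i} (f : I → Carrier) → (a • ⋁ f) ≈ ⋁ (λ j → a • f j)
    •-distribʳ : ∀ a {I : Set i} (f : I → Carrier) → (⋁ f • a) ≈ ⋁ (λ j → f j • a)

record IsDistributive {c ℓ₁ ℓ₂ i} (Q : RawBiQuantale c ℓ₁ ℓ₂ i)
                      : Set (c ⊔ ℓ₁ ⊔ lsuc i) where
  open RawBiQuantale Q
  field
    ∧-distrib-⋁ : ∀ x {I : Set i} (f : I → Carrier) → (x ∧ ⋁ f) ≈ ⋁ (λ j → x ∧ f j)
    ∨-distrib-⋀ : ∀ x {I : Set i} (f : I → Carrier) → (x ∨ ⋀ f) ≈ ⋀ (λ j → x ∨ f j)

record IsUnital {c ℓ₁ ℓ₂ i} (Q : RawBiQuantale c ℓ₁ ℓ₂ i)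
                (1∘ 1• : RawBiQuantale.Carrier Q) : Set (c ⊔ ℓ₁) where
  open RawBiQuantale Q
  field
    ∘-identityˡ : ∀ a → (1∘ ∘ a) ≈ a
    ∘-identityʳ : ∀ a → (a ∘ 1∘) ≈ a
    •-identityˡ : ∀ a → (1• • a) ≈ a
    •-identityʳ : ∀ a → (a • 1•) ≈ a

∘-Commutative : ∀ {c ℓ₁ ℓ₂ i} → RawBiQuantale c ℓ₁ ℓ₂ i → Set (c ⊔ ℓ₁)
∘-Commutative Q = ∀ a b → (a ∘ b) ≈ (b ∘ a)
  where open RawBiQuantale Q

•-Commutative : ∀ {c ℓ₁ ℓ₂ i} → RawBiQuantale c ℓ₁ ℓ₂ i → Set (c ⊔ ℓ₁)
•-Commutative Q = ∀ a b → (a • b) ≈ (b • a)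
  where open RawBiQuantale Q

module _ {c ℓ₁ ℓ₂ i} (S₁ S₂ : PartialSemigroup i) (Q : RawBiQuantale c ℓ₁ ℓ₂ i) where
  private
    module S₁ = PartialSemigroup S₁
    module S₂ = PartialSemigroup S₂
    module Q  = RawBiQuantale Q

  Fun : Set (i ⊔ c)
  Fun = S₁.Carrier → S₂.Carrier → Q.Carrier

  conv∘ : Fun → Fun → Fun
  conv∘ F G x y =
    Q.⋁ {Σ (S₁.Carrier × S₁.Carrier) (λ { (x₁ , x₂) → (x₁ S₁.· x₂) ≡ just x })}
        (λ { ((x₁ , x₂) , _) → F x₁ y Q.∘ G x₂ y })

  conv• : Fun → Fun → Fun
  conv• F G x y =
    Q.⋁ {Σ (S₂.Carrier × S₂.Carrier) (λ { (y₁ , y₂) → (y₁ S₂.· y₂) ≡ just y })}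
        (λ { ((y₁ , y₂) , _) → F x y₁ Q.• G x y₂ })

  FunBQ : RawBiQuantale (i ⊔ c) (i ⊔ ℓ₁) (i ⊔ ℓ₂) i
  FunBQ = record
    { Carrier = Fun
    ; _≈_     = λ F G → ∀ x y → F x y Q.≈ G x y
    ; _≤_     = λ F G → ∀ x y → F x y Q.≤ G x y
    ; ⋁       = λ f x y → Q.⋁ (λ j → f j x y)
    ; ⋀       = λ f x y → Q.⋀ (λ j → f j x y)
    ; _∘_     = conv∘
    ; _•_     = conv•
    }

  -- units: 𝟙∘ x y = 1∘ if x = e₁, and 0 otherwise; written as the
  -- supremum of 1∘ over the proofs of x ≡ e₁ (so no decidable equality
  -- on S₁ is needed; classically this is exactly the case split).
  𝟙∘ : S₁.Carrier → Q.Carrier → Fun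
  𝟙∘ e₁ 1∘ x y = Q.⋁ {x ≡ e₁} (λ _ → 1∘)

  𝟙• : S₂.Carrier → Q.Carrier → Fun
  𝟙• e₂ 1• x y = Q.⋁ {y ≡ e₂} (λ _ → 1•)

-- Both convolutions on Q^(S₁ × S₂) act on one coordinate only: for fixed
-- y, (F ∘ G) x y is the one-variable convolution over S₁ of the slices
-- F · y and G · y, and dually (F • G) x y convolves F x and G x over S₂.
-- The proof therefore rests on a single general fact: if S is a partial
-- semigroup and ⊙ a quantale multiplication on a complete lattice Q, then
-- the convolution of Q-valued functions on S is again a quantale
-- multiplication (congruent, associative, distributing over suprema); it
-- is unital when S is a partial monoid and ⊙ is unital, and commutative
-- when S and ⊙ are.  Associativity uses the partial associativity law of S
-- to re-bracket decompositions, the unit laws use that e·b = just x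
-- forces b = x.  The lattice structure of Q^(S₁ × S₂) is pointwise, so
-- the complete-lattice and distributivity axioms transfer coordinatewise.
module Submission where

open import Defs
open import Level using (Level; Lift; lift)
open import Data.Product using (_×_; Σ; _,_)
open import Data.Bool using (true; false)
open import Data.Maybe using (Maybe; just; _>>=_)
open import Data.Maybe.Properties using (just-injective)
open import Relation.Binary.PropositionalEquality as ≡ using (_≡_; refl; cong)
open import Relation.Binary.Structures using (IsPartialOrder)

module LatticeFacts {c ℓ₁ ℓ₂ i} (Q : RawBiQuantale c ℓ₁ ℓ₂ i) (B : IsBiQuantale Q) where
  open RawBiQuantale Q
  open IsBiQuantale B
  open IsPartialOrder isPartialOrder using (reflexive; trans; antisym; module Eq)

  ≤⋁ : ∀ {I : Set i} (f : I → Carrier) {x} j → x ≤ f j → x ≤ ⋁ f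
  ≤⋁ f j p = trans p (⋁-upper f j)

  ⋁-cong : ∀ {I : Set i} {f g : I → Carrier} → (∀ j → f j ≈ g j) → ⋁ f ≈ ⋁ g
  ⋁-cong {f = f} {g} e = antisym (⋁-least f _ (λ j → ≤⋁ g j (reflexive (e j))))
                                 (⋁-least g _ (λ j → ≤⋁ f j (reflexive (Eq.sym (e j)))))

  ⋀-cong : ∀ {I : Set i} {f g : I → Carrier} → (∀ j → f j ≈ g j) → ⋀ f ≈ ⋀ g
  ⋀-cong {f = f} {g} e =
    antisym (⋀-great g _ (λ j → trans (⋀-lower f j) (reflexive (e j))))
            (⋀-great f _ (λ j → trans (⋀-lower g j) (reflexive (Eq.sym (e j)))))

  ⋁-swap : ∀ {I J : Set i} (g : I → J → Carrier) →
           ⋁ (λ a → ⋁ (λ b → g a b)) ≈ ⋁ (λ b → ⋁ (λ a → g a b))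
  ⋁-swap g = antisym
    (⋁-least _ _ (λ a → ⋁-least _ _ (λ b → ≤⋁ _ b (⋁-upper (λ a → g a b) a))))
    (⋁-least _ _ (λ b → ⋁-least _ _ (λ a → ≤⋁ _ a (⋁-upper (λ b → g a b) b))))

bind-just : ∀ {i} {X : Set i} (m : Maybe X) (k : X → Maybe X) {x : X} →
            (m >>= k) ≡ just x → Σ X (λ v → (m ≡ just v) × (k v ≡ just x))
bind-just (just v) k e = v , refl , e

module Rebracket {i} (S : PartialSemigroup i) where
  open PartialSemigroup S renaming (Carrier to X)

  rebracketʳ : ∀ {a b z u x} → (a · b) ≡ just u → (u · z) ≡ just x →
               Σ X (λ v → ((b · z) ≡ just v) × ((a · v) ≡ just x))
  rebracketʳ {a} {b} {z} ab≡u uz≡x = bind-just (b · z) (a ·_)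
    (≡.trans (≡.sym (assoc a b z)) (≡.trans (cong (_>>= (_· z)) ab≡u) uz≡x))

  rebracketˡ : ∀ {a b z v x} → (b · z) ≡ just v → (a · v) ≡ just x →
               Σ X (λ u → ((a · b) ≡ just u) × ((u · z) ≡ just x))
  rebracketˡ {a} {b} {z} bz≡v av≡x = bind-just (a · b) (_· z)
    (≡.trans (assoc a b z) (≡.trans (cong (_>>= (a ·_)) bz≡v) av≡x))

record IsQuantaleMult {c ℓ₁ ℓ₂ i} (Q : RawBiQuantale c ℓ₁ ℓ₂ i)
       (_⊙_ : RawBiQuantale.Carrier Q → RawBiQuantale.Carrier Q → RawBiQuantale.Carrier Q)
       : Set (c Level.⊔ ℓ₁ Level.⊔ Level.suc i) where
  open RawBiQuantale Q
  field
    ⊙-cong     : ∀ {a a′ b b′} → a ≈ a′ → b ≈ b′ → (a ⊙ b) ≈ (a′ ⊙ b′)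
    ⊙-assoc    : ∀ a b c → ((a ⊙ b) ⊙ c) ≈ (a ⊙ (b ⊙ c))
    ⊙-distribˡ : ∀ a {I : Set i} (f : I → Carrier) → (a ⊙ ⋁ f) ≈ ⋁ (λ j → a ⊙ f j)
    ⊙-distribʳ : ∀ a {I : Set i} (f : I → Carrier) → (⋁ f ⊙ a) ≈ ⋁ (λ j → f j ⊙ a)

module _ {c ℓ₁ ℓ₂ i} {Q : RawBiQuantale c ℓ₁ ℓ₂ i} (B : IsBiQuantale Q) where
  open RawBiQuantale Q
  open IsBiQuantale B

  ∘-isQuantaleMult : IsQuantaleMult Q _∘_
  ∘-isQuantaleMult = record { ⊙-cong = ∘-cong ; ⊙-assoc = ∘-assoc
                            ; ⊙-distribˡ = ∘-distribˡ ; ⊙-distribʳ = ∘-distribʳ }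

  •-isQuantaleMult : IsQuantaleMult Q _•_
  •-isQuantaleMult = record { ⊙-cong = •-cong ; ⊙-assoc = •-assoc
                            ; ⊙-distribˡ = •-distribˡ ; ⊙-distribʳ = •-distribʳ }

module Convolution {c ℓ₁ ℓ₂ i} (Q : RawBiQuantale c ℓ₁ ℓ₂ i) (B : IsBiQuantale Q)
  (S : PartialSemigroup i)
  {_⊙_ : RawBiQuantale.Carrier Q → RawBiQuantale.Carrier Q → RawBiQuantale.Carrier Q}
  (M : IsQuantaleMult Q _⊙_)
  where
  open RawBiQuantale Q renaming (Carrier to C)
  open IsBiQuantale B using (⋁-upper; ⋁-least)
  open IsPartialOrder (IsBiQuantale.isPartialOrder B) using (reflexive; trans; antisym; module Eq)
  open IsQuantaleMult M
  open LatticeFacts Q B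
  open PartialSemigroup S renaming (Carrier to X)
  open Rebracket S

  Split : X → Set i
  Split x = Σ (X × X) (λ { (a , b) → (a · b) ≡ just x })

  conv : (X → C) → (X → C) → X → C
  conv f g x = ⋁ {Split x} (λ { ((a , b) , _) → f a ⊙ g b })

  term≤conv : ∀ f g {a b x} → (a · b) ≡ just x → (f a ⊙ g b) ≤ conv f g x
  term≤conv f g {a} {b} ab≡x = ⋁-upper (λ { ((a , b) , _) → f a ⊙ g b }) ((a , b) , ab≡x)

  ⊙-upperʳ : ∀ a {I : Set i} (f : I → C) j → (a ⊙ f j) ≤ (a ⊙ ⋁ f)
  ⊙-upperʳ a f j = trans (⋁-upper (λ j → a ⊙ f j) j) (reflexive (Eq.sym (⊙-distribˡ a f)))

  ⊙-upperˡ : ∀ a {I : Set i} (f : I → C) j → (f j ⊙ a) ≤ (⋁ f ⊙ a)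
  ⊙-upperˡ a f j = trans (⋁-upper (λ j → f j ⊙ a) j) (reflexive (Eq.sym (⊙-distribʳ a f)))

  ⊙-leastʳ : ∀ a {I : Set i} (f : I → C) {y} → (∀ j → (a ⊙ f j) ≤ y) → (a ⊙ ⋁ f) ≤ y
  ⊙-leastʳ a f h = trans (reflexive (⊙-distribˡ a f)) (⋁-least _ _ h)

  ⊙-leastˡ : ∀ a {I : Set i} (f : I → C) {y} → (∀ j → (f j ⊙ a) ≤ y) → (⋁ f ⊙ a) ≤ y
  ⊙-leastˡ a f h = trans (reflexive (⊙-distribʳ a f)) (⋁-least _ _ h)

  conv-cong : ∀ {f f′ g g′ : X → C} → (∀ x → f x ≈ f′ x) → (∀ x → g x ≈ g′ x) →
              ∀ x → conv f g x ≈ conv f′ g′ x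
  conv-cong ef eg x = ⋁-cong (λ { ((a , b) , _) → ⊙-cong (ef a) (eg b) })

  -- every summand of ((f*g)*h) x, namely (f a ⊙ g b) ⊙ h z with (a·b)·z = x,
  -- is also a summand (after re-bracketing) of (f*(g*h)) x; and dually
  assoc-termʳ : ∀ f g h {a b z u x} → (a · b) ≡ just u → (u · z) ≡ just x →
                ((f a ⊙ g b) ⊙ h z) ≤ conv f (conv g h) x
  assoc-termʳ f g h {a} ab≡u uz≡x with rebracketʳ ab≡u uz≡x
  ... | v , bz≡v , av≡x =
    trans (reflexive (⊙-assoc _ _ _))
      (trans (⊙-upperʳ (f a) _ (_ , bz≡v)) (term≤conv f (conv g h) av≡x))

  assoc-termˡ : ∀ f g h {a b z v x} → (b · z) ≡ just v → (a · v) ≡ just x →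
                (f a ⊙ (g b ⊙ h z)) ≤ conv (conv f g) h x
  assoc-termˡ f g h {z = z} bz≡v av≡x with rebracketˡ bz≡v av≡x
  ... | u , ab≡u , uz≡x =
    trans (reflexive (Eq.sym (⊙-assoc _ _ _)))
      (trans (⊙-upperˡ (h z) _ (_ , ab≡u)) (term≤conv (conv f g) h uz≡x))

  conv-assoc : ∀ (f g h : X → C) x → conv (conv f g) h x ≈ conv f (conv g h) x
  conv-assoc f g h x = antisym
    (⋁-least _ _ (λ { ((u , z) , uz≡x) →
       ⊙-leastˡ (h z) _ (λ { ((a , b) , ab≡u) → assoc-termʳ f g h ab≡u uz≡x }) }))
    (⋁-least _ _ (λ { ((a , v) , av≡x) →
       ⊙-leastʳ (f a) _ (λ { ((b , z) , bz≡v) → assoc-termˡ f g h bz≡v av≡x }) }))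

  -- distributivity: distribute ⊙ inside each summand, then swap the joins
  conv-distribˡ : ∀ (f : X → C) {I : Set i} (g : I → X → C) x →
     conv f (λ y → ⋁ (λ j → g j y)) x ≈ ⋁ (λ j → conv f (g j) x)
  conv-distribˡ f g x =
    Eq.trans (⋁-cong (λ { ((a , b) , _) → ⊙-distribˡ (f a) (λ j → g j b) }))
             (⋁-swap (λ { ((a , b) , _) j → f a ⊙ g j b }))

  conv-distribʳ : ∀ (f : X → C) {I : Set i} (g : I → X → C) x →
     conv (λ y → ⋁ (λ j → g j y)) f x ≈ ⋁ (λ j → conv (g j) f x)
  conv-distribʳ f g x =
    Eq.trans (⋁-cong (λ { ((a , b) , _) → ⊙-distribʳ (f b) (λ j → g j a) }))
             (⋁-swap (λ { ((a , b) , _) j → g j a ⊙ f b }))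

  -- commutativity: the swap (a , b) ↦ (b , a) matches the summands
  conv-comm : PSCommutative S → (∀ a b → (a ⊙ b) ≈ (b ⊙ a)) →
              ∀ (f g : X → C) x → conv f g x ≈ conv g f x
  conv-comm sc qc f g x = antisym (swapped f g) (swapped g f)
    where
    swapped : ∀ f g → conv f g x ≤ conv g f x
    swapped f g = ⋁-least _ _ (λ { ((a , b) , ab≡x) →
      trans (reflexive (qc (f a) (g b))) (term≤conv g f (≡.trans (sc b a) ab≡x)) })

  -- With a unit e of S and a unit `one` of ⊙, the function
  -- δ x = ⋁_{x ≡ e} one  (one at e, bottom elsewhere) is a convolution unit.
  module Unit (e : X) (U : IsPartialMonoidUnit S e) (one : C)
              (idl : ∀ a → (one ⊙ a) ≈ a) (idr : ∀ a → (a ⊙ one) ≈ a) where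
    open IsPartialMonoidUnit U

    δ : X → C
    δ x = ⋁ {x ≡ e} (λ _ → one)

    unit-splitˡ : ∀ {b x} → (e · b) ≡ just x → b ≡ x
    unit-splitˡ {b} eb≡x = just-injective (≡.trans (≡.sym (identityˡ b)) eb≡x)

    unit-splitʳ : ∀ {a x} → (a · e) ≡ just x → a ≡ x
    unit-splitʳ {a} ae≡x = just-injective (≡.trans (≡.sym (identityʳ a)) ae≡x)

    conv-unitˡ : ∀ (f : X → C) x → conv δ f x ≈ f x
    conv-unitˡ f x = antisym
      (⋁-least _ _ (λ { ((a , b) , ab≡x) → ⊙-leastˡ (f b) _ (λ { refl → bound ab≡x }) }))
      (trans (reflexive (Eq.sym (idl (f x))))
        (trans (⊙-upperˡ (f x) (λ _ → one) refl) (term≤conv δ f (identityˡ x))))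
      where
      bound : ∀ {b} → (e · b) ≡ just x → (one ⊙ f b) ≤ f x
      bound eb≡x with unit-splitˡ eb≡x
      ... | refl = reflexive (idl _)

    conv-unitʳ : ∀ (f : X → C) x → conv f δ x ≈ f x
    conv-unitʳ f x = antisym
      (⋁-least _ _ (λ { ((a , b) , ab≡x) → ⊙-leastʳ (f a) _ (λ { refl → bound ab≡x }) }))
      (trans (reflexive (Eq.sym (idr (f x))))
        (trans (⊙-upperʳ (f x) (λ _ → one) refl) (term≤conv f δ (identityʳ x))))
      where
      bound : ∀ {a} → (a · e) ≡ just x → (f a ⊙ one) ≤ f x
      bound ae≡x with unit-splitʳ ae≡x
      ... | refl = reflexive (idr _)

module FunctionSpace {c ℓ₁ ℓ₂ i} (S₁ S₂ : PartialSemigroup i)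
       (Q : RawBiQuantale c ℓ₁ ℓ₂ i) (B : IsBiQuantale Q) where
  open RawBiQuantale Q
  open IsBiQuantale B
  open IsPartialOrder isPartialOrder using (reflexive; trans; antisym; module Eq)
  open LatticeFacts Q B
  module Conv₁ = Convolution Q B S₁ (∘-isQuantaleMult B)
  module Conv₂ = Convolution Q B S₂ (•-isQuantaleMult B)
  private
    module P = RawBiQuantale (FunBQ S₁ S₂ Q)

  isBiQuantale : IsBiQuantale (FunBQ S₁ S₂ Q)
  isBiQuantale = record
    { isPartialOrder = record
      { isPreorder = record
        { isEquivalence = record
          { refl = λ x y → Eq.refl
          ; sym = λ e x y → Eq.sym (e x y)
          ; trans = λ e f x y → Eq.trans (e x y) (f x y) }
        ; reflexive = λ e x y → reflexive (e x y)
        ; trans = λ p q x y → trans (p x y) (q x y) }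
      ; antisym = λ p q x y → antisym (p x y) (q x y) }
    ; ⋁-upper = λ f j x y → ⋁-upper (λ j → f j x y) j
    ; ⋁-least = λ f G h x y → ⋁-least (λ j → f j x y) (G x y) (λ j → h j x y)
    ; ⋀-lower = λ f j x y → ⋀-lower (λ j → f j x y) j
    ; ⋀-great = λ f G h x y → ⋀-great (λ j → f j x y) (G x y) (λ j → h j x y)
    ; ∘-cong = λ eF eG x y → Conv₁.conv-cong (λ a → eF a y) (λ a → eG a y) x
    ; ∘-assoc = λ F G H x y → Conv₁.conv-assoc (λ a → F a y) (λ a → G a y) (λ a → H a y) x
    ; ∘-distribˡ = λ A f x y → Conv₁.conv-distribˡ (λ a → A a y) (λ j a → f j a y) x
    ; ∘-distribʳ = λ A f x y → Conv₁.conv-distribʳ (λ a → A a y) (λ j a → f j a y) x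
    ; •-cong = λ eF eG x y → Conv₂.conv-cong (eF x) (eG x) y
    ; •-assoc = λ F G H x y → Conv₂.conv-assoc (F x) (G x) (H x) y
    ; •-distribˡ = λ A f x y → Conv₂.conv-distribˡ (A x) (λ j b → f j x b) y
    ; •-distribʳ = λ A f x y → Conv₂.conv-distribʳ (A x) (λ j b → f j x b) y
    }

  ∧-pointwise : ∀ F G x y → P._∧_ F G x y ≈ (F x y ∧ G x y)
  ∧-pointwise F G x y = ⋀-cong (λ { (lift true) → Eq.refl ; (lift false) → Eq.refl })

  ∨-pointwise : ∀ F G x y → P._∨_ F G x y ≈ (F x y ∨ G x y)
  ∨-pointwise F G x y = ⋁-cong (λ { (lift true) → Eq.refl ; (lift false) → Eq.refl })

  isDistributive : IsDistributive Q → IsDistributive (FunBQ S₁ S₂ Q)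
  isDistributive D = record
    { ∧-distrib-⋁ = λ G f x y →
        Eq.trans (∧-pointwise G (P.⋁ f) x y)
          (Eq.trans (∧-distrib-⋁ (G x y) (λ j → f j x y))
            (⋁-cong (λ j → Eq.sym (∧-pointwise G (f j) x y))))
    ; ∨-distrib-⋀ = λ G f x y →
        Eq.trans (∨-pointwise G (P.⋀ f) x y)
          (Eq.trans (∨-distrib-⋀ (G x y) (λ j → f j x y))
            (⋀-cong (λ j → Eq.sym (∨-pointwise G (f j) x y))))
    }
    where open IsDistributive D

  isUnital : ∀ (e₁ : PartialSemigroup.Carrier S₁) (e₂ : PartialSemigroup.Carrier S₂)
    (1∘ 1• : Carrier) →
    IsPartialMonoidUnit S₁ e₁ → IsPartialMonoidUnit S₂ e₂ →
    IsUnital Q 1∘ 1• →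
    IsUnital (FunBQ S₁ S₂ Q) (𝟙∘ S₁ S₂ Q e₁ 1∘) (𝟙• S₁ S₂ Q e₂ 1•)
  isUnital e₁ e₂ 1∘ 1• U₁ U₂ UQ = record
    { ∘-identityˡ = λ F x y → Unit₁.conv-unitˡ (λ a → F a y) x
    ; ∘-identityʳ = λ F x y → Unit₁.conv-unitʳ (λ a → F a y) x
    ; •-identityˡ = λ F x y → Unit₂.conv-unitˡ (F x) y
    ; •-identityʳ = λ F x y → Unit₂.conv-unitʳ (F x) y
    }
    where
    open IsUnital UQ
    module Unit₁ = Conv₁.Unit e₁ U₁ 1∘ ∘-identityˡ ∘-identityʳ
    module Unit₂ = Conv₂.Unit e₂ U₂ 1• •-identityˡ •-identityʳ

  ∘-commutative : PSCommutative S₁ → ∘-Commutative Q → ∘-Commutative (FunBQ S₁ S₂ Q)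
  ∘-commutative sc qc F G x y = Conv₁.conv-comm sc qc (λ a → F a y) (λ a → G a y) x

  •-commutative : PSCommutative S₂ → •-Commutative Q → •-Commutative (FunBQ S₁ S₂ Q)
  •-commutative sc qc F G x y = Conv₂.conv-comm sc qc (F x) (G x) y

theorem10p5 : ∀ {c ℓ₁ ℓ₂ i : Level}
    (S₁ S₂ : PartialSemigroup i) (Q : RawBiQuantale c ℓ₁ ℓ₂ i) →
    IsBiQuantale Q →
    IsBiQuantale (FunBQ S₁ S₂ Q)
    × (IsDistributive Q → IsDistributive (FunBQ S₁ S₂ Q))
    × (∀ (e₁ : PartialSemigroup.Carrier S₁) (e₂ : PartialSemigroup.Carrier S₂)
         (1∘ 1• : RawBiQuantale.Carrier Q) →
         IsPartialMonoidUnit S₁ e₁ → IsPartialMonoidUnit S₂ e₂ →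
         IsUnital Q 1∘ 1• →
         IsUnital (FunBQ S₁ S₂ Q) (𝟙∘ S₁ S₂ Q e₁ 1∘) (𝟙• S₁ S₂ Q e₂ 1•))
    × (PSCommutative S₁ → ∘-Commutative Q → ∘-Commutative (FunBQ S₁ S₂ Q))
    × (PSCommutative S₂ → •-Commutative Q → •-Commutative (FunBQ S₁ S₂ Q))
theorem10p5 S₁ S₂ Q B =
  isBiQuantale , isDistributive , isUnital , ∘-commutative , •-commutative
  where open FunctionSpace S₁ S₂ Q B
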